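{- Suppose that there exists a constant $M$ such that $\chi_{\rho}(H)\le M$ holds for every subcubic graph $H$, and let $G$ be a subcubic graph with $\chi_{\rho}(G)=M$. If there is no subcubic graph having at least one edge in which all edges are weak, then $M\le 2\operatorname{diam}(G)+4$.
   Context: All graphs are finite and simple. A graph is subcubic if its maximum degree is at most $3$. For a graph $G$ with shortest-path distance $d_G$, a $k$-packing coloring is a map $c:V(G)\to\{1,\dots,k\}$ such that whenever $c(u)=c(v)=i$ for distinct $u,v$, we have $d_G(u,v)>i$. The packing chromatic number $\chi_{\rho}(G)$ is the smallest $k$ for which a $k$-packing coloring exists. For an edge $e$ of $G$, $S_e(G)$ is the graph obtained by subdividing $e$ once. An edge $e$ of $G$ is called weak if $\chi_{\rho}(S_e(G))<\chi_{\rho}(G)-1$. $\operatorname{diam}(G)$ denotes the diameter of $G$. -}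

module Defs where

open import Data.Nat using (ℕ; zero; suc; _+_; _*_; _∸_; _≤_; _<_)
open import Data.Fin using (Fin; zero; suc; toℕ; _≟_)
open import Data.Bool using (Bool; true; false; _∧_; _∨_; not; if_then_else_)
open import Data.List using (map; allFin)
open import Data.Nat.ListAction using (sum)
open import Data.Product using (Σ; ∃; _×_; _,_)
open import Relation.Nullary using (¬_)
open import Relation.Nullary.Decidable using (⌊_⌋)
open import Relation.Binary.PropositionalEquality using (_≡_; _≢_)

record Graph : Set where
  constructor mkGraph
  field
    n   : ℕ
    adj : Fin n → Fin n → Bool
open Graph public

IsSimple : Graph → Set
IsSimple G = (∀ u v → adj G u v ≡ adj G v u) × (∀ v → adj G v v ≡ false)

degree : (G : Graph) → Fin (n G) → ℕ
degree G v = sum (map (λ w → if adj G v w then 1 else 0) (allFin (n G)))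

IsSubcubic : Graph → Set
IsSubcubic G = IsSimple G × (∀ v → degree G v ≤ 3)

data Walk (G : Graph) : Fin (n G) → Fin (n G) → ℕ → Set where
  here : ∀ {u} → Walk G u u 0
  step : ∀ {u w v k} → adj G u w ≡ true → Walk G w v k → Walk G u v (suc k)

DistLE : (G : Graph) → Fin (n G) → Fin (n G) → ℕ → Set
DistLE G u v k = Σ ℕ (λ j → j ≤ k × Walk G u v j)

-- k-packing colouring; colour c v : Fin k represents colour toℕ (c v) + 1.
IsPackingColoring : (G : Graph) (k : ℕ) → (Fin (n G) → Fin k) → Set
IsPackingColoring G k c =
  ∀ u v → u ≢ v → c u ≡ c v → ¬ DistLE G u v (suc (toℕ (c u)))

HasPackingColoring : Graph → ℕ → Set
HasPackingColoring G k = Σ (Fin (n G) → Fin k) (IsPackingColoring G k)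

IsPackingChromaticNumber : Graph → ℕ → Set
IsPackingChromaticNumber G k =
  HasPackingColoring G k × (∀ k' → HasPackingColoring G k' → k ≤ k')

-- diam(G) = D  (maximum over pairs of the distance; only finite for connected G)
IsDiameter : Graph → ℕ → Set
IsDiameter G D =
  (∀ u v → DistLE G u v D) × (∀ D' → (∀ u v → DistLE G u v D') → D ≤ D')

-- S_e(G) for e = uv: new vertex is zero, old vertex x becomes suc x.
subdivide : (G : Graph) → Fin (n G) → Fin (n G) → Graph
subdivide G u v = mkGraph (suc (n G)) a
  where
  eq : Fin (n G) → Fin (n G) → Bool
  eq x y = ⌊ x ≟ y ⌋
  a : Fin (suc (n G)) → Fin (suc (n G)) → Bool
  a zero    zero    = false
  a zero    (suc y) = eq y u ∨ eq y v
  a (suc x) zero    = eq x u ∨ eq x v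
  a (suc x) (suc y) = adj G x y ∧ not ((eq x u ∧ eq y v) ∨ (eq x v ∧ eq y u))

IsWeakEdge : (G : Graph) → Fin (n G) → Fin (n G) → Set
IsWeakEdge G u v =
  Σ ℕ (λ k → Σ ℕ (λ k' →
    IsPackingChromaticNumber G k × IsPackingChromaticNumber (subdivide G u v) k'
    × k' < k ∸ 1))

HasEdge : Graph → Set
HasEdge G = Σ (Fin (n G)) (λ u → Σ (Fin (n G)) (λ v → adj G u v ≡ true))

AllEdgesWeak : Graph → Set
AllEdgesWeak G = ∀ u v → adj G u v ≡ true → IsWeakEdge G u v

-- Suppose M > 2 diam(G) + 4 and fix an edge e = uv of G. Glue three copies of S_e(G) to a new hub
-- adjacent to their three subdivision vertices. The result is subcubic, so it has a packing colouring
-- with at most M colours. Every vertex of S_e(G) lies within diam(G) + 1 of the subdivision vertex,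
-- so vertices in different copies are at distance at most 2 diam(G) + 4 ≤ M - 1. Hence each of the
-- colours M - 1 and M occurs in at most one copy, some copy avoids both, and restricting the colouring
-- to that copy shows χ_ρ(S_e(G)) ≤ M - 2: every edge of G is weak. G has an edge since χ_ρ(G) = M > 1.
--
-- Packing chromatic numbers are only characterised as minima, so they are obtained under double
-- negation; this is harmless because the conclusion M ≤ 2 diam(G) + 4 is decidable.
module Submission where

open import Defs
open import Data.Nat using (ℕ; zero; suc; _+_; _*_; _≤_; _<_; z≤n; s≤s; s≤s⁻¹; _≤?_)
open import Data.Nat.Properties
  using (≤-refl; ≤-reflexive; ≤-trans; ≤-antisym; <-≤-trans; n≤1+n; m≤n+m; ≰⇒>; ≮⇒≥;
         m≤n⇒m<n∨m≡n; +-assoc; +-comm; +-identityʳ; +-mono-≤; +-mono-<-≤; +-mono-≤-<;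
         +-0-commutativeMonoid; module ≤-Reasoning)
open import Data.Nat.Tactic.RingSolver using (solve-∀)
open import Data.Nat.ListAction using (sum)
open import Data.Nat.Induction using (<-rec)
open import Data.Fin using (Fin; zero; suc; toℕ; _≟_; _↑ˡ_; _↑ʳ_; splitAt; fromℕ<)
open import Data.Fin.Patterns using (0F; 1F; 2F)
open import Data.Fin.Properties
  using (any?; splitAt-↑ˡ; splitAt-↑ʳ; toℕ-injective; toℕ-fromℕ<; toℕ<n)
open import Data.Bool using (Bool; true; false; _∧_; _∨_; not; if_then_else_)
open import Data.Bool.Properties using (∧-zeroʳ; ∧-identityʳ; ∧-comm; ∨-comm; ∨-zeroʳ)
open import Data.List using (tabulate)
open import Data.List.Properties using (map-tabulate)
open import Data.Product using (Σ; _×_; _,_; proj₁; proj₂)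
open import Data.Sum using (_⊎_; inj₁; inj₂; [_,_])
open import Data.Empty using (⊥; ⊥-elim)
open import Effect.Monad using (RawMonad)
open import Level using (0ℓ)
open import Function using (_∘_; id)
open import Relation.Nullary using (¬_; Dec; yes; no; contradiction)
open import Relation.Nullary.Decidable using (⌊_⌋; ⌊⌋-map′)
open import Relation.Nullary.Negation using (¬¬-Monad)
open import Relation.Nullary.Negation.Core using (DoubleNegation)
open import Relation.Binary.PropositionalEquality
  using (_≡_; _≢_; refl; sym; trans; cong; cong₂; subst; module ≡-Reasoning)
open import Algebra.Properties.CommutativeMonoid.Sum +-0-commutativeMonoid
  using (sum-syntax; sum-cong-≗; sum-replicate-zero; ∑-distrib-+; ∑-comm)
  renaming (sum to ∑)

indicator : Bool → ℕ
indicator b = if b then 1 else 0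

∑-tabulate : ∀ k (f : Fin k → ℕ) → sum (tabulate f) ≡ ∑ f
∑-tabulate zero    f = refl
∑-tabulate (suc k) f = cong (f zero +_) (∑-tabulate k (f ∘ suc))

degree≡∑ : ∀ G v → degree G v ≡ ∑[ w < n G ] indicator (adj G v w)
degree≡∑ G v = trans (cong sum (map-tabulate id (indicator ∘ adj G v))) (∑-tabulate (n G) _)

∑-mono-≤ : ∀ {k} {f g : Fin k → ℕ} → (∀ i → f i ≤ g i) → ∑ f ≤ ∑ g
∑-mono-≤ {zero}  f≤g = ≤-refl
∑-mono-≤ {suc k} f≤g = +-mono-≤ (f≤g zero) (∑-mono-≤ (f≤g ∘ suc))

∑-mono-< : ∀ {k} {f g : Fin k → ℕ} (j : Fin k) → (∀ i → f i ≤ g i) → f j < g j → ∑ f < ∑ g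
∑-mono-< zero    f≤g fj<gj = +-mono-<-≤ fj<gj (∑-mono-≤ (f≤g ∘ suc))
∑-mono-< (suc j) f≤g fj<gj = +-mono-≤-< (f≤g zero) (∑-mono-< j (f≤g ∘ suc) fj<gj)

∑-↑ : ∀ a {b} (f : Fin (a + b) → ℕ) → ∑ f ≡ ∑[ i < a ] f (i ↑ˡ b) + ∑[ j < b ] f (a ↑ʳ j)
∑-↑ zero    f = refl
∑-↑ (suc a) f = trans (cong (f zero +_) (∑-↑ a (f ∘ suc))) (sym (+-assoc (f zero) _ _))

⌊≟⌋-refl : ∀ {k} (i : Fin k) → ⌊ i ≟ i ⌋ ≡ true
⌊≟⌋-refl i with i ≟ i
... | yes _   = refl
... | no  i≢i = contradiction refl i≢i

⌊≟⌋-sym : ∀ {k} (i j : Fin k) → ⌊ i ≟ j ⌋ ≡ ⌊ j ≟ i ⌋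
⌊≟⌋-sym i j with i ≟ j | j ≟ i
... | yes _   | yes _   = refl
... | no  _   | no  _   = refl
... | yes i≡j | no  j≢i = contradiction (sym i≡j) j≢i
... | no  i≢j | yes j≡i = contradiction (sym j≡i) i≢j

⌊≟⌋-suc : ∀ {k} (i j : Fin k) → ⌊ suc i ≟ suc j ⌋ ≡ ⌊ i ≟ j ⌋
⌊≟⌋-suc i j = ⌊⌋-map′ (cong suc) _ (i ≟ j)

indicator-∨ : ∀ a b → indicator (a ∨ b) ≤ indicator a + indicator b
indicator-∨ false b = ≤-refl
indicator-∨ true  b = s≤s z≤n

indicator-∧ : ∀ a b → indicator (a ∧ b) ≤ indicator a
indicator-∧ false b     = ≤-refl
indicator-∧ true  false = z≤n
indicator-∧ true  true  = ≤-refl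

∑-indicator-≟ : ∀ {k} (i : Fin k) → ∑[ j < k ] indicator ⌊ j ≟ i ⌋ ≡ 1
∑-indicator-≟ {suc k} zero    = cong suc (sum-replicate-zero k)
∑-indicator-≟ {suc k} (suc i) =
  trans (sum-cong-≗ (λ j → cong indicator (⌊≟⌋-suc j i))) (∑-indicator-≟ i)

∑-indicator-≟-∧ : ∀ {k} (i : Fin k) b → ∑[ j < k ] indicator (⌊ j ≟ i ⌋ ∧ b) ≡ indicator b
∑-indicator-≟-∧ {k} i false =
  trans (sum-cong-≗ (λ j → cong indicator (∧-zeroʳ ⌊ j ≟ i ⌋))) (sum-replicate-zero k)
∑-indicator-≟-∧ i true =
  trans (sum-cong-≗ (λ j → cong indicator (∧-identityʳ ⌊ j ≟ i ⌋))) (∑-indicator-≟ i)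

IsSymmetric : Graph → Set
IsSymmetric G = ∀ x y → adj G x y ≡ adj G y x

IsHomomorphism : (G H : Graph) → (Fin (n G) → Fin (n H)) → Set
IsHomomorphism G H f = ∀ x y → adj G x y ≡ true → adj H (f x) (f y) ≡ true

module _ {G : Graph} where

  infixr 5 _++ʷ_

  _++ʷ_ : ∀ {x y z j k} → Walk G x y j → Walk G y z k → Walk G x z (j + k)
  here     ++ʷ q = q
  step e p ++ʷ q = step e (p ++ʷ q)

  Walk-reverse : IsSymmetric G → ∀ {x y k} → Walk G x y k → Walk G y x k
  Walk-reverse sym-G here = here
  Walk-reverse sym-G {x} {y} {suc k} (step {w = w} e p) =
    subst (Walk G y x) (+-comm k 1) (Walk-reverse sym-G p ++ʷ step (trans (sym-G w x) e) here)

  DistLE-mono : ∀ {x y i j} → i ≤ j → DistLE G x y i → DistLE G x y j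
  DistLE-mono i≤j (k , k≤i , p) = k , ≤-trans k≤i i≤j , p

  DistLE-edge : ∀ {x y} → adj G x y ≡ true → DistLE G x y 1
  DistLE-edge e = 1 , ≤-refl , step e here

  DistLE-trans : ∀ {x y z i j} → DistLE G x y i → DistLE G y z j → DistLE G x z (i + j)
  DistLE-trans (k , k≤i , p) (l , l≤j , q) = k + l , +-mono-≤ k≤i l≤j , p ++ʷ q

  DistLE-sym : IsSymmetric G → ∀ {x y i} → DistLE G x y i → DistLE G y x i
  DistLE-sym sym-G (k , k≤i , p) = k , k≤i , Walk-reverse sym-G p

module _ {G H : Graph} (f : Fin (n G) → Fin (n H)) (hom : IsHomomorphism G H f) where

  Walk-map : ∀ {x y k} → Walk G x y k → Walk H (f x) (f y) k
  Walk-map here       = here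
  Walk-map (step e p) = step (hom _ _ e) (Walk-map p)

  DistLE-map : ∀ {x y i} → DistLE G x y i → DistLE H (f x) (f y) i
  DistLE-map (k , k≤i , p) = k , k≤i , Walk-map p

injective-packing-colouring : ∀ G → HasPackingColoring G (n G)
injective-packing-colouring G = id , λ x y x≢y x≡y _ → x≢y x≡y

edgeless-packing-colouring : ∀ {G} → ¬ HasEdge G → HasPackingColoring G 1
edgeless-packing-colouring {G} no-edge = (λ _ → zero) , packing
  where
  packing : IsPackingColoring G 1 (λ _ → zero)
  packing x .x x≢x _ (_ , z≤n , here)            = x≢x refl
  packing x y  _   _ (_ , s≤s z≤n , step xy here) = no-edge (x , y , xy)

packing-colouring-pullback : ∀ {G H k k′} (f : Fin (n G) → Fin (n H)) → IsHomomorphism G H f →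
  (∀ {x y} → f x ≡ f y → x ≡ y) → (c : Fin (n H) → Fin k) → IsPackingColoring H k c →
  (∀ x → toℕ (c (f x)) < k′) → HasPackingColoring G k′
packing-colouring-pullback {G} {H} {k} {k′} f hom f-injective c c-packing c∘f<k′ = c′ , c′-packing
  where
  c′ : Fin (n G) → Fin k′
  c′ x = fromℕ< (c∘f<k′ x)

  toℕ-c′ : ∀ x → toℕ (c′ x) ≡ toℕ (c (f x))
  toℕ-c′ x = toℕ-fromℕ< (c∘f<k′ x)

  c′-packing : IsPackingColoring G k′ c′
  c′-packing x y x≢y same x~y = c-packing (f x) (f y) (x≢y ∘ f-injective)
    (toℕ-injective (trans (sym (toℕ-c′ x)) (trans (cong toℕ same) (toℕ-c′ y))))
    (DistLE-map f hom (subst (DistLE G x y ∘ suc) (toℕ-c′ x) x~y))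

-- Subdividing an edge

module _ (G : Graph) (u v : Fin (n G)) where

  subdivide-symmetric : IsSymmetric G → IsSymmetric (subdivide G u v)
  subdivide-symmetric sym-G zero    zero    = refl
  subdivide-symmetric sym-G zero    (suc y) = refl
  subdivide-symmetric sym-G (suc x) zero    = refl
  subdivide-symmetric sym-G (suc x) (suc y) = cong₂ _∧_ (sym-G x y) (cong not (trans
    (∨-comm (⌊ x ≟ u ⌋ ∧ ⌊ y ≟ v ⌋) _)
    (cong₂ _∨_ (∧-comm ⌊ x ≟ v ⌋ _) (∧-comm ⌊ x ≟ u ⌋ _))))

  subdivide-simple : IsSimple G → IsSimple (subdivide G u v)
  subdivide-simple (sym-G , irr-G) = subdivide-symmetric sym-G , irreflexive
    where
    irreflexive : ∀ a → adj (subdivide G u v) a a ≡ false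
    irreflexive zero    = refl
    irreflexive (suc x) rewrite irr-G x = refl

  degree-subdivide-new : degree (subdivide G u v) zero ≤ 2
  degree-subdivide-new = begin
    degree (subdivide G u v) zero
      ≡⟨ degree≡∑ (subdivide G u v) zero ⟩
    ∑[ y < n G ] indicator (⌊ y ≟ u ⌋ ∨ ⌊ y ≟ v ⌋)
      ≤⟨ ∑-mono-≤ (λ y → indicator-∨ ⌊ y ≟ u ⌋ ⌊ y ≟ v ⌋) ⟩
    ∑[ y < n G ] (indicator ⌊ y ≟ u ⌋ + indicator ⌊ y ≟ v ⌋)
      ≡⟨ ∑-distrib-+ (λ y → indicator ⌊ y ≟ u ⌋) (λ y → indicator ⌊ y ≟ v ⌋) ⟩
    ∑[ y < n G ] indicator ⌊ y ≟ u ⌋ + ∑[ y < n G ] indicator ⌊ y ≟ v ⌋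
      ≡⟨ cong₂ _+_ (∑-indicator-≟ u) (∑-indicator-≟ v) ⟩
    2 ∎
    where open ≤-Reasoning

  -- In S_e(G) the vertex u trades its neighbour v for the new vertex, and symmetrically for v.
  degree-subdivide-old : IsSymmetric G → adj G u v ≡ true →
    ∀ x → degree (subdivide G u v) (suc x) ≤ degree G x
  degree-subdivide-old sym-G uv x rewrite degree≡∑ (subdivide G u v) (suc x) | degree≡∑ G x
    with x ≟ u | x ≟ v
  ... | yes refl | x≟v = ∑-mono-< v (λ y → indicator-∧ (adj G x y) _) (lost-edge uv)
    where
    lost-edge : adj G x v ≡ true →
      indicator (adj G x v ∧ not (⌊ v ≟ v ⌋ ∨ ⌊ x≟v ⌋ ∧ ⌊ v ≟ x ⌋)) < indicator (adj G x v)
    lost-edge e rewrite e | ⌊≟⌋-refl v = s≤s z≤n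
  ... | no _ | yes refl = ∑-mono-< u (λ y → indicator-∧ (adj G x y) _) (lost-edge (trans (sym-G x u) uv))
    where
    lost-edge : adj G x u ≡ true → indicator (adj G x u ∧ not ⌊ u ≟ u ⌋) < indicator (adj G x u)
    lost-edge e rewrite e | ⌊≟⌋-refl u = s≤s z≤n
  ... | no _ | no _ = ∑-mono-≤ (λ y → ≤-reflexive (cong indicator (∧-identityʳ (adj G x y))))

  subdivide-subcubic : IsSubcubic G → adj G u v ≡ true → IsSubcubic (subdivide G u v)
  subdivide-subcubic (simple , degree≤3) uv = subdivide-simple simple , degree≤3′
    where
    degree≤3′ : ∀ a → degree (subdivide G u v) a ≤ 3
    degree≤3′ zero    = ≤-trans degree-subdivide-new (n≤1+n 2)
    degree≤3′ (suc x) = ≤-trans (degree-subdivide-old (proj₁ simple) uv x) (degree≤3 x)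

  subdivide-adj-new-u : adj (subdivide G u v) (suc u) zero ≡ true
  subdivide-adj-new-u rewrite ⌊≟⌋-refl u = refl

  subdivide-adj-new-v : adj (subdivide G u v) (suc v) zero ≡ true
  subdivide-adj-new-v rewrite ⌊≟⌋-refl v = ∨-zeroʳ _

  subdivide-adj-old : ∀ {x y} → adj G x y ≡ true → x ≢ u → x ≢ v →
    adj (subdivide G u v) (suc x) (suc y) ≡ true
  subdivide-adj-old {x} xy x≢u x≢v with x ≟ u | x ≟ v
  ... | yes x≡u | _       = contradiction x≡u x≢u
  ... | no _    | yes x≡v = contradiction x≡v x≢v
  ... | no _    | no _    = trans (∧-identityʳ _) xy

  DistLE-subdivide-new : ∀ {x i} → DistLE G x u i → DistLE (subdivide G u v) (suc x) zero (suc i)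
  DistLE-subdivide-new (j , j≤i , p) = DistLE-mono (s≤s j≤i) (along p)
    where
    along : ∀ {x j} → Walk G x u j → DistLE (subdivide G u v) (suc x) zero (suc j)
    along here = DistLE-edge subdivide-adj-new-u
    along {x} (step xy p) with x ≟ u | x ≟ v
    ... | yes refl | _        = DistLE-mono (s≤s z≤n) (DistLE-edge subdivide-adj-new-u)
    ... | no _     | yes refl = DistLE-mono (s≤s z≤n) (DistLE-edge subdivide-adj-new-v)
    ... | no x≢u   | no x≢v   = DistLE-trans (DistLE-edge (subdivide-adj-old xy x≢u x≢v)) (along p)

-- Three copies of a rooted graph with their roots joined to a hub

m≤n<2+m⇒n≡m∨n≡1+m : ∀ {m n} → m ≤ n → n < 2 + m → n ≡ m ⊎ n ≡ suc m
m≤n<2+m⇒n≡m∨n≡1+m m≤n n<2+m with m≤n⇒m<n∨m≡n m≤n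
... | inj₁ m<n = inj₂ (≤-antisym (s≤s⁻¹ n<2+m) m<n)
... | inj₂ m≡n = inj₁ (sym m≡n)

two-of-three-equal : ∀ {A : Set} {p q a b c : A} →
  a ≡ p ⊎ a ≡ q → b ≡ p ⊎ b ≡ q → c ≡ p ⊎ c ≡ q → a ≡ b ⊎ a ≡ c ⊎ b ≡ c
two-of-three-equal (inj₁ a≡p) (inj₁ b≡p) _          = inj₁ (trans a≡p (sym b≡p))
two-of-three-equal (inj₂ a≡q) (inj₂ b≡q) _          = inj₁ (trans a≡q (sym b≡q))
two-of-three-equal (inj₁ a≡p) (inj₂ _)   (inj₁ c≡p) = inj₂ (inj₁ (trans a≡p (sym c≡p)))
two-of-three-equal (inj₂ a≡q) (inj₁ _)   (inj₂ c≡q) = inj₂ (inj₁ (trans a≡q (sym c≡q)))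
two-of-three-equal (inj₁ _)   (inj₂ b≡q) (inj₂ c≡q) = inj₂ (inj₂ (trans b≡q (sym c≡q)))
two-of-three-equal (inj₂ _)   (inj₁ b≡p) (inj₁ c≡p) = inj₂ (inj₂ (trans b≡p (sym c≡p)))

data TripodVertex (m : ℕ) : Set where
  hub  : TripodVertex m
  copy : Fin 3 → Fin m → TripodVertex m

copy-injective : ∀ {m i j} {x y : Fin m} → copy i x ≡ copy j y → i ≡ j × x ≡ y
copy-injective refl = refl , refl

module Tripod (K : Graph) (r : Fin (n K)) where

  private
    m = n K

  N : ℕ
  N = suc (m + (m + m))

  decode : Fin N → TripodVertex m
  decode zero    = hub
  decode (suc a) = [ copy 0F , [ copy 1F , copy 2F ] ∘ splitAt m ] (splitAt m a)

  embed : Fin 3 → Fin m → Fin N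
  embed 0F x = suc (x ↑ˡ (m + m))
  embed 1F x = suc (m ↑ʳ (x ↑ˡ m))
  embed 2F x = suc (m ↑ʳ (m ↑ʳ x))

  decode-embed : ∀ i x → decode (embed i x) ≡ copy i x
  decode-embed 0F x rewrite splitAt-↑ˡ m x (m + m) = refl
  decode-embed 1F x rewrite splitAt-↑ʳ m (m + m) (x ↑ˡ m) | splitAt-↑ˡ m x m = refl
  decode-embed 2F x rewrite splitAt-↑ʳ m (m + m) (m ↑ʳ x) | splitAt-↑ʳ m m x = refl

  embed-injective : ∀ {i j x y} → embed i x ≡ embed j y → i ≡ j × x ≡ y
  embed-injective {i} {j} {x} {y} eq =
    copy-injective (trans (sym (decode-embed i x)) (trans (cong decode eq) (decode-embed j y)))

  adjacent : TripodVertex m → TripodVertex m → Bool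
  adjacent hub        hub        = false
  adjacent hub        (copy _ y) = ⌊ y ≟ r ⌋
  adjacent (copy _ x) hub        = ⌊ x ≟ r ⌋
  adjacent (copy i x) (copy j y) = ⌊ j ≟ i ⌋ ∧ adj K x y

  tripod : Graph
  tripod = mkGraph N (λ a b → adjacent (decode a) (decode b))

  ∑-decode : (f : TripodVertex m → ℕ) →
    ∑[ a < N ] f (decode a) ≡ f hub + ∑[ i < 3 ] ∑[ x < m ] f (copy i x)
  ∑-decode f = cong (f hub +_) (begin
    ∑[ a < m + (m + m) ] f (decode (suc a))
      ≡⟨ ∑-↑ m (f ∘ decode ∘ suc) ⟩
    in-block 0F + ∑[ b < m + m ] f (decode (suc (m ↑ʳ b)))
      ≡⟨ cong (in-block 0F +_) (∑-↑ m (λ b → f (decode (suc (m ↑ʳ b))))) ⟩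
    in-block 0F + (in-block 1F + in-block 2F)
      ≡⟨ cong₂ _+_ (in-copy 0F) (cong₂ _+_ (in-copy 1F) (trans (in-copy 2F) (sym (+-identityʳ _)))) ⟩
    ∑[ i < 3 ] ∑[ x < m ] f (copy i x) ∎)
    where
    open ≡-Reasoning
    in-block : Fin 3 → ℕ
    in-block i = ∑[ x < m ] f (decode (embed i x))
    in-copy : ∀ i → in-block i ≡ ∑[ x < m ] f (copy i x)
    in-copy i = sum-cong-≗ (cong f ∘ decode-embed i)

  tripod-symmetric : IsSymmetric K → IsSymmetric tripod
  tripod-symmetric sym-K a b = symmetric (decode a) (decode b)
    where
    symmetric : ∀ c d → adjacent c d ≡ adjacent d c
    symmetric hub        hub        = refl
    symmetric hub        (copy _ _) = refl
    symmetric (copy _ _) hub        = refl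
    symmetric (copy i x) (copy j y) = cong₂ _∧_ (⌊≟⌋-sym j i) (sym-K x y)

  tripod-simple : IsSimple K → IsSimple tripod
  tripod-simple (sym-K , irr-K) = tripod-symmetric sym-K , irreflexive ∘ decode
    where
    irreflexive : ∀ c → adjacent c c ≡ false
    irreflexive hub        = refl
    irreflexive (copy i x) rewrite irr-K x = ∧-zeroʳ _

  vertex-degree : TripodVertex m → ℕ
  vertex-degree hub        = 3
  vertex-degree (copy _ x) = indicator ⌊ x ≟ r ⌋ + degree K x

  degree-tripod : ∀ a → degree tripod a ≡ vertex-degree (decode a)
  degree-tripod a = trans (degree≡∑ tripod a)
    (trans (∑-decode (indicator ∘ adjacent (decode a))) (neighbours (decode a)))
    where
    open ≡-Reasoning
    neighbours : ∀ c →
      indicator (adjacent c hub) + ∑[ j < 3 ] ∑[ y < m ] indicator (adjacent c (copy j y)) ≡ vertex-degree c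
    neighbours hub        = cong (0 +_) (sum-cong-≗ {3} (λ _ → ∑-indicator-≟ r))
    neighbours (copy i x) = cong (indicator ⌊ x ≟ r ⌋ +_) (begin
      ∑[ j < 3 ] ∑[ y < m ] indicator (⌊ j ≟ i ⌋ ∧ adj K x y)
        ≡⟨ ∑-comm (λ j y → indicator (⌊ j ≟ i ⌋ ∧ adj K x y)) ⟩
      ∑[ y < m ] ∑[ j < 3 ] indicator (⌊ j ≟ i ⌋ ∧ adj K x y)
        ≡⟨ sum-cong-≗ (λ y → ∑-indicator-≟-∧ i (adj K x y)) ⟩
      ∑[ y < m ] indicator (adj K x y)
        ≡⟨ degree≡∑ K x ⟨
      degree K x ∎)

  tripod-subcubic : IsSubcubic K → degree K r ≤ 2 → IsSubcubic tripod
  tripod-subcubic (simple , degree≤3) root≤2 =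
    tripod-simple simple , λ a → subst (_≤ 3) (sym (degree-tripod a)) (bounded (decode a))
    where
    bounded : ∀ c → vertex-degree c ≤ 3
    bounded hub = ≤-refl
    bounded (copy _ x) with x ≟ r
    ... | yes refl = s≤s root≤2
    ... | no _     = degree≤3 x

  embed-homomorphism : ∀ i → IsHomomorphism K tripod (embed i)
  embed-homomorphism i x y xy rewrite decode-embed i x | decode-embed i y | ⌊≟⌋-refl i = xy

  DistLE-root-hub : ∀ i → DistLE tripod (embed i r) zero 1
  DistLE-root-hub i = DistLE-edge root-adj-hub
    where
    root-adj-hub : adj tripod (embed i r) zero ≡ true
    root-adj-hub rewrite decode-embed i r = ⌊≟⌋-refl r

  DistLE-across : IsSymmetric K → ∀ i j {x y a b} → DistLE K x r a → DistLE K y r b →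
    DistLE tripod (embed i x) (embed j y) (a + (2 + b))
  DistLE-across sym-K i j x→r y→r =
    DistLE-trans (DistLE-map (embed i) (embed-homomorphism i) x→r)
      (DistLE-trans (DistLE-root-hub i)
        (DistLE-trans (DistLE-sym (tripod-symmetric sym-K) (DistLE-root-hub j))
          (DistLE-sym (tripod-symmetric sym-K) (DistLE-map (embed j) (embed-homomorphism j) y→r))))

  -- The two largest colours (toℕ ≥ M) each occur in at most one copy, so some copy avoids both.
  copy-without-large-colours : ∀ {k M} (c : Fin N → Fin k) → IsPackingColoring tripod k c →
    k ≤ 2 + M → (∀ i j x y → DistLE tripod (embed i x) (embed j y) (suc M)) →
    Σ (Fin 3) λ i → ∀ x → toℕ (c (embed i x)) < M
  copy-without-large-colours {k} {M} c c-packing k≤2+M close =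
    choose (any? (large? 0F)) (any? (large? 1F)) (any? (large? 2F))
    where
    Large : Fin 3 → Fin m → Set
    Large i x = M ≤ toℕ (c (embed i x))

    large? : ∀ i x → Dec (Large i x)
    large? i x = M ≤? toℕ (c (embed i x))

    two-values : ∀ i {x} → Large i x → toℕ (c (embed i x)) ≡ M ⊎ toℕ (c (embed i x)) ≡ suc M
    two-values i {x} l = m≤n<2+m⇒n≡m∨n≡1+m l (<-≤-trans (toℕ<n (c (embed i x))) k≤2+M)

    clash : ∀ i j x y → i ≢ j → Large i x → toℕ (c (embed i x)) ≢ toℕ (c (embed j y))
    clash i j x y i≢j l same = c-packing (embed i x) (embed j y) (i≢j ∘ proj₁ ∘ embed-injective)
      (toℕ-injective same) (DistLE-mono (s≤s l) (close i j x y))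

    choose : Dec (Σ (Fin m) (Large 0F)) → Dec (Σ (Fin m) (Large 1F)) → Dec (Σ (Fin m) (Large 2F)) →
      Σ (Fin 3) λ i → ∀ x → toℕ (c (embed i x)) < M
    choose (no none) _         _         = 0F , λ x → ≰⇒> (none ∘ (x ,_))
    choose (yes _)   (no none) _         = 1F , λ x → ≰⇒> (none ∘ (x ,_))
    choose (yes _)   (yes _)   (no none) = 2F , λ x → ≰⇒> (none ∘ (x ,_))
    choose (yes (x₀ , l₀)) (yes (x₁ , l₁)) (yes (x₂ , l₂))
      with two-of-three-equal (two-values 0F l₀) (two-values 1F l₁) (two-values 2F l₂)
    ... | inj₁ same        = contradiction same (clash 0F 1F x₀ x₁ (λ ()) l₀)
    ... | inj₂ (inj₁ same) = contradiction same (clash 0F 2F x₀ x₂ (λ ()) l₀)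
    ... | inj₂ (inj₂ same) = contradiction same (clash 1F 2F x₁ x₂ (λ ()) l₁)

-- Minima under double negation

open RawMonad (¬¬-Monad {a = 0ℓ}) using (_>>=_; pure)

¬¬-minimal : (P : ℕ → Set) → ∀ {k} → P k → DoubleNegation (Σ ℕ λ j → P j × ∀ i → P i → j ≤ i)
¬¬-minimal P {k} Pk no-minimal = <-rec (λ j → ¬ P j) not-minimal k Pk
  where
  not-minimal : ∀ j → (∀ {i} → i < j → ¬ P i) → ¬ P j
  not-minimal j below Pj = no-minimal (j , Pj , λ i Pi → ≮⇒≥ (λ i<j → below i<j Pi))

¬¬-Π-Fin : ∀ {k} {P : Fin k → Set} → (∀ i → DoubleNegation (P i)) → DoubleNegation (∀ i → P i)
¬¬-Π-Fin {zero}  ¬¬P = pure λ ()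
¬¬-Π-Fin {suc k} ¬¬P = do
  P₀ ← ¬¬P zero
  Pₛ ← ¬¬-Π-Fin (¬¬P ∘ suc)
  pure λ where
    zero    → P₀
    (suc i) → Pₛ i

¬¬-→ : ∀ {A B : Set} → (A → DoubleNegation B) → DoubleNegation (A → B)
¬¬-→ f ¬[A→B] = ¬[A→B] λ a → contradiction (λ b → ¬[A→B] λ _ → b) (f a)

¬¬-packing-chromatic-number : ∀ G → DoubleNegation (Σ ℕ (IsPackingChromaticNumber G))
¬¬-packing-chromatic-number G = ¬¬-minimal (HasPackingColoring G) (injective-packing-colouring G)

SubcubicPackingBound : ℕ → Set
SubcubicPackingBound M = ∀ (H : Graph) → IsSubcubic H → ∀ k → IsPackingChromaticNumber H k → k ≤ M

module _ {M D : ℕ} {G : Graph} (bounded : SubcubicPackingBound (2 + M))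
  (G-subcubic : IsSubcubic G) (χG : IsPackingChromaticNumber G (2 + M))
  (close : ∀ x y → DistLE G x y D) (large : 2 * D + 4 ≤ suc M) where

  every-edge-weak : ∀ u v → adj G u v ≡ true → DoubleNegation (IsWeakEdge G u v)
  every-edge-weak u v uv = do
    (kT , (cT , cT-packing) , kT-minimal) ← ¬¬-packing-chromatic-number tripod
    let kT≤2+M      = bounded tripod T-subcubic kT ((cT , cT-packing) , kT-minimal)
        (i , small) = copy-without-large-colours cT cT-packing kT≤2+M far
        S-coloured  = packing-colouring-pullback (embed i) (embed-homomorphism i)
                        (proj₂ ∘ embed-injective) cT cT-packing small
    (kS , χS) ← ¬¬-packing-chromatic-number S
    pure (2 + M , kS , χG , χS , s≤s (proj₂ χS M S-coloured))
    where
    S : Graph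
    S = subdivide G u v
    open Tripod S zero

    S-subcubic : IsSubcubic S
    S-subcubic = subdivide-subcubic G u v G-subcubic uv

    T-subcubic : IsSubcubic tripod
    T-subcubic = tripod-subcubic S-subcubic (degree-subdivide-new G u v)

    to-new : ∀ x → DistLE S x zero (suc D)
    to-new zero    = 0 , z≤n , here
    to-new (suc x) = DistLE-subdivide-new G u v (close x u)

    far : ∀ i j x y → DistLE tripod (embed i x) (embed j y) (suc M)
    far i j x y = DistLE-mono (≤-trans (≤-reflexive (length D)) large)
      (DistLE-across (proj₁ (proj₁ S-subcubic)) i j (to-new x) (to-new y))
      where
      length : ∀ D → suc D + (2 + suc D) ≡ 2 * D + 4
      length = solve-∀

  all-edges-weak : DoubleNegation (HasEdge G × AllEdgesWeak G)
  all-edges-weak = do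
    e ← has-edge
    w ← ¬¬-Π-Fin λ u → ¬¬-Π-Fin λ v → ¬¬-→ (every-edge-weak u v)
    pure (e , w)
    where
    has-edge : DoubleNegation (HasEdge G)
    has-edge no-edge with proj₂ χG 1 (edgeless-packing-colouring no-edge)
    ... | s≤s ()

corollary2p4 : (M : ℕ) →
    (∀ (H : Graph) → IsSubcubic H → ∀ k → IsPackingChromaticNumber H k → k ≤ M) →
    (G : Graph) → IsSubcubic G → IsPackingChromaticNumber G M →
    ¬ (Σ Graph (λ H → IsSubcubic H × HasEdge H × AllEdgesWeak H)) →
    ∀ D → IsDiameter G D → M ≤ 2 * D + 4
corollary2p4 M bounded G G-subcubic χG no-weak-graph D (close , _) with M ≤? 2 * D + 4
... | yes M≤2D+4 = M≤2D+4
... | no  M≰2D+4 = ⊥-elim (large-χ-absurd M (≰⇒> M≰2D+4) bounded χG)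
  where
  large-χ-absurd : ∀ M → 2 * D + 4 < M → SubcubicPackingBound M → IsPackingChromaticNumber G M → ⊥
  large-χ-absurd 1 (s≤s 2D+4≤0) _ _ = contradiction (≤-trans (m≤n+m 4 (2 * D)) 2D+4≤0) λ ()
  large-χ-absurd (suc (suc M)) (s≤s large) bounded χG =
    all-edges-weak bounded G-subcubic χG close large
      (λ (has-edge , weak) → no-weak-graph (G , G-subcubic , has-edge , weak))
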